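{- Let $a,b$ be integers with $a-1>b\ge 1$, let $\varphi(0)=0^a1$, $\varphi(1)=0^b1$, let $u_\beta=\lim_{n\to\infty}\varphi^n(0)$, and let $T(w)=0^b1\varphi(w)0^b$. Let $p,q$ be palindromes in ${\cal L}(u_\beta)$. If $q$ is a central factor of $p$, then $T(q)$ is a central factor of $T(p)$.
   Context: ${\cal L}(u_\beta)$ is the set of finite factors of $u_\beta$. For $w=w_1\cdots w_n$, $\overline w=w_n\cdots w_1$; a palindrome is a word with $w=\overline w$. A palindrome $q$ is a central factor of a palindrome $p$ if there is a finite word $w\in{\cal L}(u_\beta)$ with $p=wq\overline{w}$. -}

module Defs where

open import Data.Nat using (ℕ; zero; suc)
open import Data.List using (List; []; _∷_; _++_; reverse; replicate; concatMap)
open import Data.Product using (∃; ∃-syntax; _×_)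
open import Relation.Binary.PropositionalEquality using (_≡_)

data Letter : Set where
  𝟎 𝟏 : Letter

Word : Set
Word = List Letter

mirror : Word → Word
mirror = reverse

IsPalindrome : Word → Set
IsPalindrome w = w ≡ mirror w

φ-letter : ℕ → ℕ → Letter → Word
φ-letter a b 𝟎 = replicate a 𝟎 ++ (𝟏 ∷ [])
φ-letter a b 𝟏 = replicate b 𝟎 ++ (𝟏 ∷ [])

φ : ℕ → ℕ → Word → Word
φ a b = concatMap (φ-letter a b)

φ^_[0] : ℕ → ℕ → ℕ → Word
φ^_[0] a b zero    = 𝟎 ∷ []
φ^_[0] a b (suc n) = φ a b (φ^_[0] a b n)

_IsFactorOf_ : Word → Word → Set
u IsFactorOf v = ∃[ x ] ∃[ y ] (v ≡ x ++ u ++ y)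

-- Language L(u_β): since φ(0) starts with 0, each φ^n(0) is a prefix of
-- φ^{n+1}(0) and u_β = lim φ^n(0); its finite factors are exactly the
-- factors of some φ^n(0).
InL : ℕ → ℕ → Word → Set
InL a b w = ∃[ n ] (w IsFactorOf φ^_[0] a b n)

T : ℕ → ℕ → Word → Word
T a b w = replicate b 𝟎 ++ (𝟏 ∷ []) ++ φ a b w ++ replicate b 𝟎

IsCentralFactor : ℕ → ℕ → Word → Word → Set
IsCentralFactor a b q p = ∃[ w ] (InL a b w × p ≡ w ++ q ++ mirror w)

{-# OPTIONS --safe #-}
-- Since b ≤ a, every φ(c) ends in 0ᵇ1, so 0ᵇ1φ(w) = w′0ᵇ1 for some word w′.
-- Each 1φ(c) = 10ᵏ1 is a palindrome, hence the mirror image of 1φ(w) is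
-- 1φ(w̄), and mirroring the first identity gives φ(w̄)0ᵇ = 0ᵇw̄′.  Together
-- these turn T(wqw̄) = 0ᵇ1φ(w)·φ(q)·φ(w̄)0ᵇ into w′·T(q)·w̄′.  Finally w′ ∈ L(u_β):
-- w has a nonempty left extension vw ∈ L(u_β) (as φⁿ⁺¹(0) starts with
-- φⁿ(0)φⁿ(0)), and 0ᵇ1φ(w), of which w′ is a prefix, is a suffix of φ(vw).
module Submission where

open import Defs
open import Data.Nat using (ℕ; zero; suc; _+_; _∸_; _≤_; _<_; s≤s; z≤n)
open import Data.Nat.Properties using (m∸n+n≡m; ≤-trans; n≤1+n)
open import Data.List using (List; []; _∷_; _++_; _∷ʳ_; reverse; replicate; concatMap)
open import Data.List.Properties
  using (++-assoc; ++-identityʳ; ++-monoid; concatMap-++; reverse-++; unfold-reverse; ∷-injectiveʳ)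
open import Data.Product using (∃₂; ∃-syntax; _,_)
open import Relation.Binary.PropositionalEquality using (_≡_; refl; sym; trans; cong; cong₂; module ≡-Reasoning)
open import Algebra.Solver.Monoid (++-monoid Letter) using (solve; _⊜_; _⊕_) renaming (id to ε)
open ≡-Reasoning

private variable
  A B : Set
  m n : ℕ
  u v w w′ q : Word

replicate-+ : ∀ m n (x : A) → replicate (m + n) x ≡ replicate m x ++ replicate n x
replicate-+ zero    n x = refl
replicate-+ (suc m) n x = cong (x ∷_) (replicate-+ m n x)

replicate-∷ʳ : ∀ n (x : A) → replicate n x ∷ʳ x ≡ x ∷ replicate n x
replicate-∷ʳ zero    x = refl
replicate-∷ʳ (suc n) x = cong (x ∷_) (replicate-∷ʳ n x)

reverse-replicate : ∀ n (x : A) → reverse (replicate n x) ≡ replicate n x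
reverse-replicate zero    x = refl
reverse-replicate (suc n) x = begin
  reverse (x ∷ replicate n x)   ≡⟨ unfold-reverse x (replicate n x) ⟩
  reverse (replicate n x) ∷ʳ x  ≡⟨ cong (_∷ʳ x) (reverse-replicate n x) ⟩
  replicate n x ∷ʳ x            ≡⟨ replicate-∷ʳ n x ⟩
  x ∷ replicate n x             ∎

replicate-suffix : m ≤ n → (x : A) → ∃[ xs ] replicate n x ≡ xs ++ replicate m x
replicate-suffix {m} {n} m≤n x = replicate (n ∸ m) x ,
  trans (cong (λ k → replicate k x) (sym (m∸n+n≡m m≤n))) (replicate-+ (n ∸ m) m x)

reverse-∷-replicate-∷ʳ : ∀ n (x y : A) → reverse (y ∷ replicate n x ∷ʳ y) ≡ y ∷ replicate n x ∷ʳ y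
reverse-∷-replicate-∷ʳ n x y = begin
  reverse (y ∷ replicate n x ∷ʳ y)            ≡⟨ unfold-reverse y (replicate n x ∷ʳ y) ⟩
  reverse (replicate n x ∷ʳ y) ∷ʳ y           ≡⟨ cong (_∷ʳ y) (reverse-++ (replicate n x) (y ∷ [])) ⟩
  (y ∷ reverse (replicate n x)) ∷ʳ y          ≡⟨ cong (λ xs → (y ∷ xs) ∷ʳ y) (reverse-replicate n x) ⟩
  y ∷ replicate n x ∷ʳ y                      ∎

reverse-∷-concatMap : (f : A → List B) (x : B) → (∀ c → x ∷ f c ≡ reverse (x ∷ f c)) →
                      ∀ w → reverse (x ∷ concatMap f w) ≡ x ∷ concatMap f (reverse w)
reverse-∷-concatMap f x x∷f-palindrome []      = refl
reverse-∷-concatMap {A = A} {B = B} f x x∷f-palindrome (c ∷ w) = begin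
  reverse ((x ∷ f c) ++ F w)             ≡⟨ reverse-++ (x ∷ f c) (F w) ⟩
  reverse (F w) ++ reverse (x ∷ f c)     ≡⟨ cong (reverse (F w) ++_) (sym (x∷f-palindrome c)) ⟩
  reverse (F w) ++ x ∷ f c               ≡⟨ sym (++-assoc (reverse (F w)) (x ∷ []) (f c)) ⟩
  (reverse (F w) ∷ʳ x) ++ f c            ≡⟨ cong (_++ f c) (sym (unfold-reverse x (F w))) ⟩
  reverse (x ∷ F w) ++ f c               ≡⟨ cong (_++ f c) (reverse-∷-concatMap f x x∷f-palindrome w) ⟩
  x ∷ F (reverse w) ++ f c               ≡⟨ cong (λ ys → x ∷ F (reverse w) ++ ys) (sym (++-identityʳ (f c))) ⟩
  x ∷ F (reverse w) ++ F (c ∷ [])        ≡⟨ cong (x ∷_) (sym (concatMap-++ f (reverse w) (c ∷ []))) ⟩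
  x ∷ F (reverse w ∷ʳ c)                 ≡⟨ cong (λ ys → x ∷ F ys) (sym (unfold-reverse c w)) ⟩
  x ∷ F (reverse (c ∷ w))                ∎
  where
  F : List A → List B
  F = concatMap f

IsFactorOf-trans : u IsFactorOf v → v IsFactorOf w → u IsFactorOf w
IsFactorOf-trans {u} (x , y , refl) (x′ , y′ , refl) = x′ ++ x , y ++ y′ ,
  solve 5 (λ x′ x u y y′ → x′ ⊕ (x ⊕ u ⊕ y) ⊕ y′ ⊜ (x′ ⊕ x) ⊕ u ⊕ y ⊕ y′) refl x′ x u y y′

module Morphism (a b : ℕ) where

  𝟎ᵇ : Word
  𝟎ᵇ = replicate b 𝟎

  𝟎ᵇ𝟏 : Word
  𝟎ᵇ𝟏 = 𝟎ᵇ ∷ʳ 𝟏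

  φⁿ0 : ℕ → Word
  φⁿ0 = φ^_[0] a b

  φ-++ : ∀ u v → φ a b (u ++ v) ≡ φ a b u ++ φ a b v
  φ-++ = concatMap-++ (φ-letter a b)

  φ-IsFactorOf : u IsFactorOf v → φ a b u IsFactorOf φ a b v
  φ-IsFactorOf {u} (x , y , refl) = φ a b x , φ a b y ,
    trans (φ-++ x (u ++ y)) (cong (φ a b x ++_) (φ-++ u y))

  InL-factor : u IsFactorOf v → InL a b v → InL a b u
  InL-factor u≼v (n , v≼φⁿ0) = n , IsFactorOf-trans u≼v v≼φⁿ0

  InL-φ : InL a b w → InL a b (φ a b w)
  InL-φ (n , w≼φⁿ0) = suc n , φ-IsFactorOf w≼φⁿ0

  φ^-head : 1 ≤ a → ∀ n → ∃[ s ] φⁿ0 n ≡ 𝟎 ∷ s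
  φ^-head _          zero    = [] , refl
  φ^-head 1≤a@(s≤s _) (suc n) with φ^-head 1≤a n
  ... | s , φⁿ0≡0s = _ , cong (φ a b) φⁿ0≡0s

  φ^-doubling : 2 ≤ a → ∀ n → ∃[ r ] φⁿ0 (suc n) ≡ φⁿ0 n ++ φⁿ0 n ++ r
  φ^-doubling (s≤s (s≤s {n = a′} _)) zero = (replicate a′ 𝟎 ∷ʳ 𝟏) ++ [] , refl
  φ^-doubling 2≤a (suc n) with φ^-doubling 2≤a n
  ... | r , doubling = φ a b r , (begin
    φ a b (φⁿ0 (suc n))                    ≡⟨ cong (φ a b) doubling ⟩
    φ a b (φⁿ0 n ++ φⁿ0 n ++ r)            ≡⟨ φ-++ (φⁿ0 n) (φⁿ0 n ++ r) ⟩
    φⁿ0 (suc n) ++ φ a b (φⁿ0 n ++ r)      ≡⟨ cong (φⁿ0 (suc n) ++_) (φ-++ (φⁿ0 n) r) ⟩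
    φⁿ0 (suc n) ++ φⁿ0 (suc n) ++ φ a b r  ∎)

  InL-extendˡ : 2 ≤ a → InL a b w → ∃₂ λ c v → InL a b (c ∷ v ++ w)
  InL-extendˡ {w} 2≤a (n , x , y , φⁿ0≡xwy)
    with φ^-doubling 2≤a n | φ^-head (≤-trans (s≤s z≤n) 2≤a) n
  ... | r , doubling | s , φⁿ0≡0s = 𝟎 , s ++ x , suc n , [] , y ++ r , (begin
    φⁿ0 (suc n)                      ≡⟨ doubling ⟩
    φⁿ0 n ++ φⁿ0 n ++ r              ≡⟨ cong₂ (λ xs ys → xs ++ ys ++ r) φⁿ0≡0s φⁿ0≡xwy ⟩
    (𝟎 ∷ s) ++ (x ++ w ++ y) ++ r    ≡⟨ solve 6 (λ z s x w y r → (z ⊕ s) ⊕ (x ⊕ w ⊕ y) ⊕ r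
                                                ⊜ (z ⊕ (s ⊕ x) ⊕ w) ⊕ y ⊕ r) refl (𝟎 ∷ []) s x w y r ⟩
    (𝟎 ∷ (s ++ x) ++ w) ++ y ++ r    ∎)

  φ-letter-ends-𝟎ᵇ𝟏 : b ≤ a → ∀ c → ∃[ M ] φ-letter a b c ≡ M ++ 𝟎ᵇ𝟏
  φ-letter-ends-𝟎ᵇ𝟏 b≤a 𝟎 with replicate-suffix b≤a 𝟎
  ... | M , 𝟎ᵃ≡M𝟎ᵇ = M , trans (cong (_∷ʳ 𝟏) 𝟎ᵃ≡M𝟎ᵇ) (++-assoc M 𝟎ᵇ (𝟏 ∷ []))
  φ-letter-ends-𝟎ᵇ𝟏 _   𝟏 = [] , refl

  φ-ends-𝟎ᵇ𝟏 : b ≤ a → ∀ c w → ∃[ M ] φ a b (c ∷ w) ≡ M ++ 𝟎ᵇ𝟏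
  φ-ends-𝟎ᵇ𝟏 b≤a c [] with φ-letter-ends-𝟎ᵇ𝟏 b≤a c
  ... | M , φc≡M𝟎ᵇ𝟏 = M , trans (++-identityʳ (φ-letter a b c)) φc≡M𝟎ᵇ𝟏
  φ-ends-𝟎ᵇ𝟏 b≤a c (d ∷ w) with φ-ends-𝟎ᵇ𝟏 b≤a d w
  ... | M , φdw≡M𝟎ᵇ𝟏 = φ-letter a b c ++ M ,
    trans (cong (φ-letter a b c ++_) φdw≡M𝟎ᵇ𝟏) (sym (++-assoc (φ-letter a b c) M 𝟎ᵇ𝟏))

  InL-𝟎ᵇ𝟏φ : 2 ≤ a → b ≤ a → InL a b w → InL a b (𝟎ᵇ ++ 𝟏 ∷ φ a b w)
  InL-𝟎ᵇ𝟏φ {w} 2≤a b≤a w∈L with InL-extendˡ 2≤a w∈L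
  ... | c , v , cvw∈L with φ-ends-𝟎ᵇ𝟏 b≤a c v
  ... | M , φcv≡M𝟎ᵇ𝟏 = InL-factor (M , [] , (begin
    φ a b (c ∷ v ++ w)               ≡⟨ φ-++ (c ∷ v) w ⟩
    φ a b (c ∷ v) ++ φ a b w         ≡⟨ cong (_++ φ a b w) φcv≡M𝟎ᵇ𝟏 ⟩
    (M ++ 𝟎ᵇ𝟏) ++ φ a b w            ≡⟨ solve 4 (λ M 𝟎ᵇ 𝟏 φw → (M ⊕ 𝟎ᵇ ⊕ 𝟏) ⊕ φw ⊜ M ⊕ (𝟎ᵇ ⊕ 𝟏 ⊕ φw) ⊕ ε) refl
                                                M 𝟎ᵇ (𝟏 ∷ []) (φ a b w) ⟩
    M ++ (𝟎ᵇ ++ 𝟏 ∷ φ a b w) ++ []   ∎)) (InL-φ cvw∈L)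

  𝟎ᵇ𝟏φ-shift : b ≤ a → ∀ w → ∃[ w′ ] 𝟎ᵇ ++ 𝟏 ∷ φ a b w ≡ w′ ++ 𝟎ᵇ𝟏
  𝟎ᵇ𝟏φ-shift _   []      = [] , refl
  𝟎ᵇ𝟏φ-shift b≤a (c ∷ w) with φ-ends-𝟎ᵇ𝟏 b≤a c w
  ... | M , φcw≡M𝟎ᵇ𝟏 = 𝟎ᵇ ++ 𝟏 ∷ M ,
    trans (cong (λ xs → 𝟎ᵇ ++ 𝟏 ∷ xs) φcw≡M𝟎ᵇ𝟏) (sym (++-assoc 𝟎ᵇ (𝟏 ∷ M) 𝟎ᵇ𝟏))

  reverse-𝟎ᵇ𝟏 : reverse 𝟎ᵇ𝟏 ≡ 𝟏 ∷ 𝟎ᵇ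
  reverse-𝟎ᵇ𝟏 = trans (reverse-++ 𝟎ᵇ (𝟏 ∷ [])) (cong (𝟏 ∷_) (reverse-replicate b 𝟎))

  reverse-𝟏φ : ∀ w → reverse (𝟏 ∷ φ a b w) ≡ 𝟏 ∷ φ a b (reverse w)
  reverse-𝟏φ = reverse-∷-concatMap (φ-letter a b) 𝟏 𝟏φ-letter-palindrome
    where
    𝟏φ-letter-palindrome : ∀ c → IsPalindrome (𝟏 ∷ φ-letter a b c)
    𝟏φ-letter-palindrome 𝟎 = sym (reverse-∷-replicate-∷ʳ a 𝟎 𝟏)
    𝟏φ-letter-palindrome 𝟏 = sym (reverse-∷-replicate-∷ʳ b 𝟎 𝟏)

  φ-mirror-shift : 𝟎ᵇ ++ 𝟏 ∷ φ a b w ≡ w′ ++ 𝟎ᵇ𝟏 → φ a b (mirror w) ++ 𝟎ᵇ ≡ 𝟎ᵇ ++ mirror w′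
  φ-mirror-shift {w} {w′} shift = ∷-injectiveʳ (begin
    𝟏 ∷ φ a b (reverse w) ++ 𝟎ᵇ           ≡⟨ cong₂ _++_ (sym (reverse-𝟏φ w)) (sym (reverse-replicate b 𝟎)) ⟩
    reverse (𝟏 ∷ φ a b w) ++ reverse 𝟎ᵇ   ≡⟨ sym (reverse-++ 𝟎ᵇ (𝟏 ∷ φ a b w)) ⟩
    reverse (𝟎ᵇ ++ 𝟏 ∷ φ a b w)           ≡⟨ cong reverse shift ⟩
    reverse (w′ ++ 𝟎ᵇ𝟏)                   ≡⟨ reverse-++ w′ 𝟎ᵇ𝟏 ⟩
    reverse 𝟎ᵇ𝟏 ++ reverse w′             ≡⟨ cong (_++ reverse w′) reverse-𝟎ᵇ𝟏 ⟩
    𝟏 ∷ 𝟎ᵇ ++ reverse w′                  ∎)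

  T-sandwich : 𝟎ᵇ ++ 𝟏 ∷ φ a b w ≡ w′ ++ 𝟎ᵇ𝟏 → φ a b (mirror w) ++ 𝟎ᵇ ≡ 𝟎ᵇ ++ mirror w′ →
               T a b (w ++ q ++ mirror w) ≡ w′ ++ T a b q ++ mirror w′
  T-sandwich {w} {w′} {q} left right = begin
    𝟎ᵇ ++ 𝟏 ∷ φ a b (w ++ q ++ w̄) ++ 𝟎ᵇ
      ≡⟨ cong (λ xs → 𝟎ᵇ ++ 𝟏 ∷ xs ++ 𝟎ᵇ) (trans (φ-++ w (q ++ w̄)) (cong (φ a b w ++_) (φ-++ q w̄))) ⟩
    𝟎ᵇ ++ 𝟏 ∷ (φ a b w ++ φ a b q ++ φ a b w̄) ++ 𝟎ᵇ
      ≡⟨ solve 5 (λ 𝟎ᵇ 𝟏 φw φq φw̄ → 𝟎ᵇ ⊕ 𝟏 ⊕ (φw ⊕ φq ⊕ φw̄) ⊕ 𝟎ᵇ ⊜ (𝟎ᵇ ⊕ 𝟏 ⊕ φw) ⊕ φq ⊕ (φw̄ ⊕ 𝟎ᵇ)) refl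
                 𝟎ᵇ (𝟏 ∷ []) (φ a b w) (φ a b q) (φ a b w̄) ⟩
    (𝟎ᵇ ++ 𝟏 ∷ φ a b w) ++ φ a b q ++ (φ a b w̄ ++ 𝟎ᵇ)
      ≡⟨ cong₂ (λ xs ys → xs ++ φ a b q ++ ys) left right ⟩
    (w′ ++ 𝟎ᵇ𝟏) ++ φ a b q ++ (𝟎ᵇ ++ w̄′)
      ≡⟨ solve 5 (λ w′ 𝟎ᵇ 𝟏 φq w̄′ → (w′ ⊕ 𝟎ᵇ ⊕ 𝟏) ⊕ φq ⊕ (𝟎ᵇ ⊕ w̄′) ⊜ w′ ⊕ (𝟎ᵇ ⊕ 𝟏 ⊕ φq ⊕ 𝟎ᵇ) ⊕ w̄′) refl
                 w′ 𝟎ᵇ (𝟏 ∷ []) (φ a b q) w̄′ ⟩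
    w′ ++ (𝟎ᵇ ++ 𝟏 ∷ φ a b q ++ 𝟎ᵇ) ++ w̄′
      ∎
    where
    w̄ w̄′ : Word
    w̄ = mirror w
    w̄′ = mirror w′

  T-central-factor : 2 ≤ a → b ≤ a → InL a b w → IsCentralFactor a b (T a b q) (T a b (w ++ q ++ mirror w))
  T-central-factor {w} {q} 2≤a b≤a w∈L with 𝟎ᵇ𝟏φ-shift b≤a w
  ... | w′ , shift = w′ , InL-factor ([] , 𝟎ᵇ𝟏 , shift) (InL-𝟎ᵇ𝟏φ 2≤a b≤a w∈L) ,
                     T-sandwich {w} {w′} {q} shift (φ-mirror-shift {w} {w′} shift)

-- Only the factorisation p = w q w̄ with w ∈ L(u_β) is needed: neither
-- palindromicity, nor b ≥ 1, nor p, q ∈ L(u_β) enters the argument.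
lemma5p10 : (a b : ℕ) → 1 ≤ b → suc b < a →
    (p q : Word) → IsPalindrome p → IsPalindrome q →
    InL a b p → InL a b q →
    IsCentralFactor a b q p →
    IsCentralFactor a b (T a b q) (T a b p)
lemma5p10 a b _ b+1<a p q _ _ _ _ (w , w∈L , refl) = Morphism.T-central-factor a b 2≤a b≤a w∈L
  where
  2≤a : 2 ≤ a
  2≤a = ≤-trans (s≤s (s≤s z≤n)) b+1<a
  b≤a : b ≤ a
  b≤a = ≤-trans (n≤1+n b) (≤-trans (n≤1+n (suc b)) b+1<a)
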